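{- Let $L$ be an $n\times n$ invertible matrix with integer entries. Suppose $D$ is a non-negative $n\times n$ diagonal matrix and $M$ is an $n\times n$ matrix such that both $M$ and $DM$ are M-matrices. Then the superstable configurations and the critical configurations of $S^+$ are the same under the pairing $(L,M)$ and under the pairing $(L,DM)$.
   Context: An M-matrix is a real non-singular $n\times n$ matrix $M$ with $M_{ij}\le 0$ for $i\ne j$, $M_{ii}>0$ for all $i$, and all entries of $M^{ -1}$ non-negative. Inequalities between vectors are componentwise; $e_i$ is the $i$th standard basis vector. For a pairing $(L,K)$ with $K$ an M-matrix, set $N=LK^{ -1}$ and $S^+=\{Nx : x\in\mathbb{R}^n,\ x\ge 0,\ Nx\in\mathbb{Z}^n\}$ (the valid configurations for that pairing). With respect to this $S^+$ and firing by $L$: $f\in S^+$ is stable if $f-Le_i\notin S^+$ for all $i$; reachable if there is $g\in S^+$ with (i) $g-Le_i\in S^+$ for all $i$ and (ii) $f=g-\sum_{j=1}^kLe_{i_j}$ for some sequence $i_1,\dots,i_k$ with $g-\sum_{j=1}^lLe_{i_j}\in S^+$ for all $l\le k$; critical if stable and reachable; superstable if $f-Lz\notin S^+$ for every $z\in\mathbb{Z}^n$ with $z\ge 0$, $z\ne 0$. -}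

module Defs where

open import Level using (Level; suc; _⊔_)
open import Data.Nat using (ℕ; zero) renaming (suc to sucℕ)
open import Data.Fin using (Fin) renaming (zero to fzero; suc to fsuc)
open import Data.Integer as ℤ using (ℤ; +_; -[1+_])
open import Data.List using (List; []; _∷_)
open import Data.Product using (Σ; ∃; _×_; _,_)
open import Data.Sum using (_⊎_)
open import Relation.Nullary using (¬_)
open import Relation.Binary.PropositionalEquality using (_≡_)
open import Algebra.Structures using (IsCommutativeRing)

-- A model of the real numbers: a complete (Dedekind / least-upper-bound)
-- ordered field.  All such structures are isomorphic to ℝ, so
-- quantifying over them is the same as speaking about ℝ.

record RealField : Set₁ where
  infixl 7 _*_
  infixl 6 _+_
  infix  4 _≈_ _<_ _≤_
  field
    Carrier : Set
    _≈_     : Carrier → Carrier → Set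
    _+_     : Carrier → Carrier → Carrier
    _*_     : Carrier → Carrier → Carrier
    -_      : Carrier → Carrier
    0#      : Carrier
    1#      : Carrier
    isCommutativeRing : IsCommutativeRing _≈_ _+_ _*_ -_ 0# 1#
    0≉1     : ¬ (0# ≈ 1#)
    inverse : ∀ x → ¬ (x ≈ 0#) → ∃ λ y → x * y ≈ 1#
    _<_     : Carrier → Carrier → Set
    <-irrefl : ∀ {x y} → x ≈ y → ¬ (x < y)
    <-trans  : ∀ {x y z} → x < y → y < z → x < z
    <-resp-≈ : ∀ {x x' y y'} → x ≈ x' → y ≈ y' → x < y → x' < y'
    <-trichotomy : ∀ x y → x < y ⊎ (x ≈ y ⊎ y < x)
    +-mono-<  : ∀ {x y} z → x < y → x + z < y + z
    *-pos     : ∀ {x y} → 0# < x → 0# < y → 0# < x * y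
    lub : (P : Carrier → Set) → (∃ λ x → P x) →
          (∃ λ b → ∀ x → P x → (x < b ⊎ x ≈ b)) →
          ∃ λ s → (∀ x → P x → (x < s ⊎ x ≈ s)) ×
                  (∀ b → (∀ x → P x → (x < b ⊎ x ≈ b)) → (s < b ⊎ s ≈ b))

  _≤_ : Carrier → Carrier → Set
  x ≤ y = x < y ⊎ x ≈ y

module Linear (R : RealField) where
  open RealField R

  Vecℝ : ℕ → Set
  Vecℝ n = Fin n → Carrier

  Mat : ℕ → Set
  Mat n = Fin n → Fin n → Carrier

  Σ[<_]_ : (n : ℕ) → (Fin n → Carrier) → Carrier
  Σ[< zero ] f = 0#
  Σ[< sucℕ n ] f = f fzero + Σ[< n ] (λ i → f (fsuc i))

  _·_ : ∀ {n} → Mat n → Mat n → Mat n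
  _·_ {n} A B i j = Σ[< n ] (λ k → A i k * B k j)

  _·ᵥ_ : ∀ {n} → Mat n → Vecℝ n → Vecℝ n
  _·ᵥ_ {n} A x i = Σ[< n ] (λ k → A i k * x k)

  δ : ∀ {n} → Fin n → Fin n → Carrier
  δ fzero fzero = 1#
  δ fzero (fsuc j) = 0#
  δ (fsuc i) fzero = 0#
  δ (fsuc i) (fsuc j) = δ i j

  Id : ∀ {n} → Mat n
  Id = δ

  _≈ᴹ_ : ∀ {n} → Mat n → Mat n → Set
  A ≈ᴹ B = ∀ i j → A i j ≈ B i j

  IsInverse : ∀ {n} → Mat n → Mat n → Set
  IsInverse A B = ((A · B) ≈ᴹ Id) × ((B · A) ≈ᴹ Id)

  Invertible : ∀ {n} → Mat n → Set
  Invertible A = ∃ λ B → IsInverse A B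

  fromℕ : ℕ → Carrier
  fromℕ zero = 0#
  fromℕ (sucℕ k) = 1# + fromℕ k

  fromℤ : ℤ → Carrier
  fromℤ (+ k) = fromℕ k
  fromℤ -[1+ k ] = - (1# + fromℕ k)

  ZMat : ℕ → Set
  ZMat n = Fin n → Fin n → ℤ

  ZVec : ℕ → Set
  ZVec n = Fin n → ℤ

  toℝ : ∀ {n} → ZMat n → Mat n
  toℝ L i j = fromℤ (L i j)

  -- M-matrix: non-singular, off-diagonal ≤ 0, diagonal > 0, inverse ≥ 0.
  -- The inverse is carried as part of the data (it is unique).
  record MMatrix {n : ℕ} (M : Mat n) : Set where
    field
      inv       : Mat n
      isInverse : IsInverse M inv
      offDiag   : ∀ i j → ¬ (i ≡ j) → M i j ≤ 0#
      diagPos   : ∀ i → 0# < M i i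
      invNonneg : ∀ i j → 0# ≤ inv i j

  NonnegDiagonal : ∀ {n} → Mat n → Set
  NonnegDiagonal D = (∀ i j → ¬ (i ≡ j) → D i j ≈ 0#) × (∀ i → 0# ≤ D i i)

  module Pairing {n : ℕ} (L : ZMat n) {K : Mat n} (mK : MMatrix K) where
    open MMatrix mK

    N : Mat n
    N = toℝ L · inv

    S⁺ : ZVec n → Set
    S⁺ f = ∃ λ (x : Vecℝ n) → (∀ i → 0# ≤ x i) × (∀ i → (N ·ᵥ x) i ≈ fromℤ (f i))

    fire : ZVec n → Fin n → ZVec n
    fire f i r = f r ℤ.- L r i

    fireBy : ZVec n → ZVec n → ZVec n
    fireBy f z r = f r ℤ.- sumℤ n (λ k → L r k ℤ.* z k)
      where
      sumℤ : (m : ℕ) → (Fin m → ℤ) → ℤ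
      sumℤ zero g = + 0
      sumℤ (sucℕ m) g = g fzero ℤ.+ sumℤ m (λ k → g (fsuc k))

    Stable : ZVec n → Set
    Stable f = S⁺ f × (∀ i → ¬ S⁺ (fire f i))

    LegalSeq : ZVec n → List (Fin n) → ZVec n → Set
    LegalSeq g [] f = ∀ r → f r ≡ g r
    LegalSeq g (i ∷ is) f = S⁺ (fire g i) × LegalSeq (fire g i) is f

    Reachable : ZVec n → Set
    Reachable f = S⁺ f × (∃ λ g → S⁺ g × (∀ i → S⁺ (fire g i)) ×
                                  (∃ λ is → LegalSeq g is f))

    Critical : ZVec n → Set
    Critical f = Stable f × Reachable f

    Superstable : ZVec n → Set
    Superstable f = S⁺ f × (∀ (z : ZVec n) → (∀ i → + 0 ℤ.≤ z i) →
                              ¬ (∀ i → z i ≡ + 0) → ¬ S⁺ (fireBy f z))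

-- The scaling x ↦ D x is a bijection of the non-negative orthant (D has positive
-- diagonal, since D M does), and (D M)⁻¹ D = M⁻¹, so L M⁻¹ x = L (D M)⁻¹ (D x).
-- Hence both pairings have literally the same set S⁺, and every notion of the
-- theorem is defined from S⁺ and L alone.
module Submission where

open import Defs
open import Data.Nat as ℕ using (ℕ; suc)
open import Data.Fin using (Fin; zero; suc; punchIn)
open import Data.Fin.Properties using (punchInᵢ≢i)
open import Data.Product using (_×_; _,_; proj₁; proj₂; ∃)
open import Data.Sum using (inj₁; inj₂)
open import Data.Empty using (⊥-elim)
open import Data.List using ([]; _∷_)
open import Relation.Nullary using (¬_)
open import Relation.Binary.PropositionalEquality as ≡ using (_≡_)
open import Relation.Binary.Bundles using (Setoid)
open import Function.Base using (_∘_)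
open import Function.Bundles using (_⇔_; mk⇔; Equivalence)
import Function.Properties.Equivalence as ⇔
open import Algebra.Bundles using (CommutativeRing)
open import Algebra.Structures using (IsCommutativeRing)
import Algebra.Properties.Ring as RingProperties
import Algebra.Properties.Semiring.Sum as SumProperties
import Relation.Binary.Reasoning.Setoid as SetoidReasoning

module MatrixAlgebra (R : RealField) where
  open RealField R
  open Linear R
  open IsCommutativeRing isCommutativeRing hiding (zero)

  ℝ-commutativeRing : CommutativeRing _ _
  ℝ-commutativeRing = record { isCommutativeRing = isCommutativeRing }

  open SumProperties (CommutativeRing.semiring ℝ-commutativeRing)
    using (sum; sum-cong-≋; sum-cong-≗; ∑-comm; *-distribˡ-sum; *-distribʳ-sum; sum-remove; sum-replicate-zero)

  Σ≡sum : ∀ {n} (t : Fin n → Carrier) → Σ[< n ] t ≡ sum t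
  Σ≡sum {ℕ.zero} t = ≡.refl
  Σ≡sum {suc n}  t = ≡.cong (t zero +_) (Σ≡sum (λ k → t (suc k)))

  Σ-cong : ∀ {n} {s t : Fin n → Carrier} → (∀ k → s k ≈ t k) → Σ[< n ] s ≈ Σ[< n ] t
  Σ-cong {s = s} {t} s≈t rewrite Σ≡sum s | Σ≡sum t = sum-cong-≋ s≈t

  Σ-*ˡ : ∀ {n} x (t : Fin n → Carrier) → x * Σ[< n ] t ≈ Σ[< n ] (λ k → x * t k)
  Σ-*ˡ x t rewrite Σ≡sum t | Σ≡sum (λ k → x * t k) = *-distribˡ-sum x t

  Σ-*ʳ : ∀ {n} x (t : Fin n → Carrier) → Σ[< n ] t * x ≈ Σ[< n ] (λ k → t k * x)
  Σ-*ʳ x t rewrite Σ≡sum t | Σ≡sum (λ k → t k * x) = *-distribʳ-sum x t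

  ΣΣ≡sumsum : ∀ {m n} (t : Fin m → Fin n → Carrier) →
              Σ[< m ] (λ i → Σ[< n ] (t i)) ≡ sum (λ i → sum (t i))
  ΣΣ≡sumsum {n = n} t = ≡.trans (Σ≡sum (λ i → Σ[< n ] (t i))) (sum-cong-≗ (λ i → Σ≡sum (t i)))

  Σ-comm : ∀ {m n} (t : Fin m → Fin n → Carrier) →
           Σ[< m ] (λ i → Σ[< n ] (t i)) ≈ Σ[< n ] (λ j → Σ[< m ] (λ i → t i j))
  Σ-comm t rewrite ΣΣ≡sumsum t | ΣΣ≡sumsum (λ j i → t i j) = ∑-comm t

  Σ-single : ∀ {n} (i : Fin n) (t : Fin n → Carrier) →
             (∀ k → ¬ i ≡ k → t k ≈ 0#) → Σ[< n ] t ≈ t i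
  Σ-single {suc n} i t t≈0 = begin
    Σ[< suc n ] t                    ≡⟨ Σ≡sum t ⟩
    sum t                            ≈⟨ sum-remove t ⟩
    t i + sum {n} (t ∘ punchIn i)     ≈⟨ +-congˡ (sum-cong-≋ {n} (λ k → t≈0 _ (punchInᵢ≢i i k ∘ ≡.sym))) ⟩
    t i + sum {n} (λ _ → 0#)         ≈⟨ +-congˡ (sum-replicate-zero n) ⟩
    t i + 0#                         ≈⟨ +-identityʳ (t i) ⟩
    t i                              ∎
    where open SetoidReasoning setoid

  δ-diag : ∀ {n} (i : Fin n) → δ i i ≈ 1#
  δ-diag zero    = refl
  δ-diag (suc i) = δ-diag i

  δ-off : ∀ {n} (i k : Fin n) → ¬ i ≡ k → δ i k ≈ 0#
  δ-off zero    zero    i≢k = ⊥-elim (i≢k ≡.refl)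
  δ-off zero    (suc k) i≢k = refl
  δ-off (suc i) zero    i≢k = refl
  δ-off (suc i) (suc k) i≢k = δ-off i k (i≢k ∘ ≡.cong suc)

  module _ {n : ℕ} where

    ≈ᴹ-setoid : Setoid _ _
    ≈ᴹ-setoid = record
      { Carrier = Mat n
      ; _≈_ = _≈ᴹ_
      ; isEquivalence = record
        { refl = λ i j → refl
        ; sym = λ A≈B i j → sym (A≈B i j)
        ; trans = λ A≈B B≈C i j → trans (A≈B i j) (B≈C i j)
        }
      }

    ·-cong : {A A' B B' : Mat n} → A ≈ᴹ A' → B ≈ᴹ B' → (A · B) ≈ᴹ (A' · B')
    ·-cong A≈A' B≈B' i j = Σ-cong (λ k → *-cong (A≈A' i k) (B≈B' k j))

    ·-assoc : (A B C : Mat n) → ((A · B) · C) ≈ᴹ (A · (B · C))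
    ·-assoc A B C i j = begin
      Σ[< n ] (λ k → Σ[< n ] (λ l → A i l * B l k) * C k j)
        ≈⟨ Σ-cong (λ k → Σ-*ʳ (C k j) (λ l → A i l * B l k)) ⟩
      Σ[< n ] (λ k → Σ[< n ] (λ l → A i l * B l k * C k j))
        ≈⟨ Σ-comm (λ k l → A i l * B l k * C k j) ⟩
      Σ[< n ] (λ l → Σ[< n ] (λ k → A i l * B l k * C k j))
        ≈⟨ Σ-cong (λ l → Σ-cong (λ k → *-assoc (A i l) (B l k) (C k j))) ⟩
      Σ[< n ] (λ l → Σ[< n ] (λ k → A i l * (B l k * C k j)))
        ≈⟨ Σ-cong (λ l → Σ-*ˡ (A i l) (λ k → B l k * C k j)) ⟨
      Σ[< n ] (λ l → A i l * Σ[< n ] (λ k → B l k * C k j)) ∎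
      where open SetoidReasoning setoid

    ·-identityˡ : (A : Mat n) → (Id · A) ≈ᴹ A
    ·-identityˡ A i j = begin
      Σ[< n ] (λ k → δ i k * A k j)
        ≈⟨ Σ-single i _ (λ k i≢k → trans (*-congʳ (δ-off i k i≢k)) (zeroˡ _)) ⟩
      δ i i * A i j  ≈⟨ *-congʳ (δ-diag i) ⟩
      1# * A i j     ≈⟨ *-identityˡ _ ⟩
      A i j          ∎
      where open SetoidReasoning setoid

    ·-identityʳ : (A : Mat n) → (A · Id) ≈ᴹ A
    ·-identityʳ A i j = begin
      Σ[< n ] (λ k → A i k * δ k j)
        ≈⟨ Σ-single j _ (λ k j≢k → trans (*-congˡ (δ-off k j (j≢k ∘ ≡.sym))) (zeroʳ _)) ⟩
      A i j * δ j j  ≈⟨ *-congˡ (δ-diag j) ⟩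
      A i j * 1#     ≈⟨ *-identityʳ _ ⟩
      A i j          ∎
      where open SetoidReasoning setoid

    columns : Vecℝ n → Mat n
    columns x k _ = x k

    ·-congˡ : (A : Mat n) {B B' : Mat n} → B ≈ᴹ B' → (A · B) ≈ᴹ (A · B')
    ·-congˡ A = ·-cong (λ _ _ → refl)

    ·-congʳ : (C : Mat n) {A A' : Mat n} → A ≈ᴹ A' → (A · C) ≈ᴹ (A' · C)
    ·-congʳ C A≈A' = ·-cong A≈A' (λ _ _ → refl)

    ·ᵥ-congʳ : (x : Vecℝ n) {A A' : Mat n} → A ≈ᴹ A' → ∀ i → (A ·ᵥ x) i ≈ (A' ·ᵥ x) i
    ·ᵥ-congʳ x A≈A' i = ·-congʳ (columns x) A≈A' i i

    ·ᵥ-congˡ : (A : Mat n) {x x' : Vecℝ n} → (∀ k → x k ≈ x' k) → ∀ i → (A ·ᵥ x) i ≈ (A ·ᵥ x') i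
    ·ᵥ-congˡ A x≈x' i = ·-congˡ A (λ k _ → x≈x' k) i i

    ·ᵥ-assoc : (A B : Mat n) (x : Vecℝ n) → ∀ i → ((A · B) ·ᵥ x) i ≈ (A ·ᵥ (B ·ᵥ x)) i
    ·ᵥ-assoc A B x i = ·-assoc A B (columns x) i i

    DiagonalMatrix : Mat n → Set
    DiagonalMatrix D = ∀ i k → ¬ i ≡ k → D i k ≈ 0#

    diagonal-·ᵥ : {D : Mat n} → DiagonalMatrix D → (x : Vecℝ n) → ∀ i → (D ·ᵥ x) i ≈ D i i * x i
    diagonal-·ᵥ D-diag x i = Σ-single i _ (λ k i≢k → trans (*-congʳ (D-diag i k i≢k)) (zeroˡ _))

    rightInverse≈leftInverse·factor : {A B D M : Mat n} →
      (B · (D · M)) ≈ᴹ Id → (M · A) ≈ᴹ Id → A ≈ᴹ (B · D)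
    rightInverse≈leftInverse·factor {A} {B} {D} {M} B·DM≈Id M·A≈Id = begin
      A                ≈⟨ ·-identityˡ A ⟨
      Id · A           ≈⟨ ·-congʳ A B·DM≈Id ⟨
      (B · (D · M)) · A ≈⟨ ·-congʳ A (·-assoc B D M) ⟨
      ((B · D) · M) · A ≈⟨ ·-assoc (B · D) M A ⟩
      (B · D) · (M · A) ≈⟨ ·-congˡ (B · D) M·A≈Id ⟩
      (B · D) · Id      ≈⟨ ·-identityʳ (B · D) ⟩
      B · D             ∎
      where open SetoidReasoning ≈ᴹ-setoid

module Order (R : RealField) where
  open RealField R
  open IsCommutativeRing isCommutativeRing
  open RingProperties (CommutativeRing.ring (MatrixAlgebra.ℝ-commutativeRing R))
    using (-‿distribˡ-*; -‿distribʳ-*; -‿involutive)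

  x<0⇒0<-x : ∀ {x} → x < 0# → 0# < - x
  x<0⇒0<-x {x} x<0 = <-resp-≈ (-‿inverseʳ x) (+-identityˡ (- x)) (+-mono-< (- x) x<0)

  0<-x⇒x<0 : ∀ {x} → 0# < - x → x < 0#
  0<-x⇒x<0 {x} 0<-x = <-resp-≈ (+-identityˡ x) (-‿inverseˡ x) (+-mono-< x 0<-x)

  0<1 : 0# < 1#
  0<1 with <-trichotomy 0# 1#
  ... | inj₁ 0<1          = 0<1
  ... | inj₂ (inj₁ 0≈1)   = ⊥-elim (0≉1 0≈1)
  ... | inj₂ (inj₂ 1<0)   = ⊥-elim (<-irrefl refl (<-trans 0<-1*-1 1<0))
    where
    -1*-1≈1 : - 1# * - 1# ≈ 1#
    -1*-1≈1 = trans (sym (-‿distribˡ-* 1# (- 1#))) (trans (-‿cong (*-identityˡ (- 1#))) (-‿involutive 1#))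
    0<-1*-1 : 0# < 1#
    0<-1*-1 = <-resp-≈ refl -1*-1≈1 (*-pos (x<0⇒0<-x 1<0) (x<0⇒0<-x 1<0))

  *-nonneg : ∀ {a b} → 0# ≤ a → 0# ≤ b → 0# ≤ a * b
  *-nonneg (inj₁ 0<a) (inj₁ 0<b) = inj₁ (*-pos 0<a 0<b)
  *-nonneg {a} {b} (inj₂ 0≈a) _  = inj₂ (trans (sym (zeroˡ b)) (*-congʳ 0≈a))
  *-nonneg {a} {b} (inj₁ _) (inj₂ 0≈b) = inj₂ (trans (sym (zeroʳ a)) (*-congˡ 0≈b))

  inverse-nonneg : ∀ {a b} → 0# < a → a * b ≈ 1# → 0# ≤ b
  inverse-nonneg {a} {b} 0<a ab≈1 with <-trichotomy 0# b
  ... | inj₁ 0<b        = inj₁ 0<b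
  ... | inj₂ (inj₁ 0≈b) = inj₂ 0≈b
  ... | inj₂ (inj₂ b<0) = ⊥-elim (<-irrefl refl (<-trans 0<1 (0<-x⇒x<0 0<-1)))
    where
    0<-1 : 0# < - 1#
    0<-1 = <-resp-≈ refl (trans (sym (-‿distribʳ-* a b)) (-‿cong ab≈1)) (*-pos 0<a (x<0⇒0<-x b<0))

  ≤-respʳ-≈ : ∀ {x y z} → x ≤ y → y ≈ z → x ≤ z
  ≤-respʳ-≈ (inj₁ x<y) y≈z = inj₁ (<-resp-≈ refl y≈z x<y)
  ≤-respʳ-≈ (inj₂ x≈y) y≈z = inj₂ (trans x≈y y≈z)

module Configurations (R : RealField) where
  open RealField R
  open Linear R
  open IsCommutativeRing isCommutativeRing hiding (zero)
  open MatrixAlgebra R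
  open Order R

  EqualS⁺ : ∀ {n} (L : ZMat n) {K K' : Mat n} → MMatrix K → MMatrix K' → Set
  EqualS⁺ L mK mK' = ∀ f → Pairing.S⁺ L mK f ⇔ Pairing.S⁺ L mK' f

  EqualS⁺-sym : ∀ {n} (L : ZMat n) {K K' : Mat n} (mK : MMatrix K) (mK' : MMatrix K') →
                EqualS⁺ L mK mK' → EqualS⁺ L mK' mK
  EqualS⁺-sym L mK mK' same f = ⇔.sym (same f)

  module _ {n} (L : ZMat n) {K K' : Mat n} (mK : MMatrix K) (mK' : MMatrix K')
           (same : EqualS⁺ L mK mK') where
    private
      module P  = Pairing L mK
      module P′ = Pairing L mK'
      to : ∀ f → P.S⁺ f → P′.S⁺ f
      to f = Equivalence.to (same f)
      from : ∀ f → P′.S⁺ f → P.S⁺ f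
      from f = Equivalence.from (same f)

    legalSeq-transfer : ∀ g is f → P.LegalSeq g is f → P′.LegalSeq g is f
    legalSeq-transfer g []       f g≡f            = g≡f
    legalSeq-transfer g (i ∷ is) f (legal , rest) =
      to (P.fire g i) legal , legalSeq-transfer (P.fire g i) is f rest

    superstable-transfer : ∀ f → P.Superstable f → P′.Superstable f
    superstable-transfer f (f∈S⁺ , noFiring) =
      to f f∈S⁺ , λ z z≥0 z≢0 fired → noFiring z z≥0 z≢0 (from (P.fireBy f z) fired)

    critical-transfer : ∀ f → P.Critical f → P′.Critical f
    critical-transfer f ((f∈S⁺ , unstable) , (f∈S⁺′ , g , g∈S⁺ , gFires , is , legal)) =
      (to f f∈S⁺ , λ i fired → unstable i (from (P.fire f i) fired)) ,
      (to f f∈S⁺′ , g , to g g∈S⁺ , (λ i → to (P.fire g i) (gFires i)) , is , legalSeq-transfer g is f legal)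

  superstable-⇔ : ∀ {n} (L : ZMat n) {K K' : Mat n} (mK : MMatrix K) (mK' : MMatrix K') →
    EqualS⁺ L mK mK' → ∀ f → Pairing.Superstable L mK f ⇔ Pairing.Superstable L mK' f
  superstable-⇔ L mK mK' same f =
    mk⇔ (superstable-transfer L mK mK' same f) (superstable-transfer L mK' mK (EqualS⁺-sym L mK mK' same) f)

  critical-⇔ : ∀ {n} (L : ZMat n) {K K' : Mat n} (mK : MMatrix K) (mK' : MMatrix K') →
    EqualS⁺ L mK mK' → ∀ f → Pairing.Critical L mK f ⇔ Pairing.Critical L mK' f
  critical-⇔ L mK mK' same f =
    mk⇔ (critical-transfer L mK mK' same f) (critical-transfer L mK' mK (EqualS⁺-sym L mK mK' same) f)

  PositiveDiagonal : ∀ {n} → Mat n → Set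
  PositiveDiagonal D = DiagonalMatrix D × (∀ i → 0# < D i i)

  S⁺-invariant-under-diagonalRescaling :
    ∀ {n} (L : ZMat n) {K K' D : Mat n} (mK : MMatrix K) (mK' : MMatrix K') →
    PositiveDiagonal D → MMatrix.inv mK ≈ᴹ (MMatrix.inv mK' · D) → EqualS⁺ L mK mK'
  S⁺-invariant-under-diagonalRescaling L {D = D} mK mK' (D-diag , D>0) A≈B·D f = mk⇔
    (λ (x , x≥0 , Nx≈f) → D ·ᵥ x , Dx≥0 x≥0 , λ i → trans (sym (N·x≈N′·Dx x i)) (Nx≈f i))
    (λ (y , y≥0 , N′y≈f) → D⁻¹y y , D⁻¹y≥0 y≥0 , λ i → begin
      ((toℝ L · A) ·ᵥ D⁻¹y y) i         ≈⟨ N·x≈N′·Dx (D⁻¹y y) i ⟩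
      ((toℝ L · B) ·ᵥ (D ·ᵥ D⁻¹y y)) i  ≈⟨ ·ᵥ-congˡ (toℝ L · B) (D·D⁻¹y y) i ⟩
      ((toℝ L · B) ·ᵥ y) i              ≈⟨ N′y≈f i ⟩
      fromℤ (f i)                       ∎)
    where
    open SetoidReasoning setoid
    A = MMatrix.inv mK
    B = MMatrix.inv mK'

    N·x≈N′·Dx : (x : Vecℝ _) → ∀ i → ((toℝ L · A) ·ᵥ x) i ≈ ((toℝ L · B) ·ᵥ (D ·ᵥ x)) i
    N·x≈N′·Dx x i = begin
      ((toℝ L · A) ·ᵥ x) i        ≈⟨ ·ᵥ-congʳ x (·-congˡ (toℝ L) A≈B·D) i ⟩
      ((toℝ L · (B · D)) ·ᵥ x) i  ≈⟨ ·ᵥ-congʳ x (·-assoc (toℝ L) B D) i ⟨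
      (((toℝ L · B) · D) ·ᵥ x) i  ≈⟨ ·ᵥ-assoc (toℝ L · B) D x i ⟩
      ((toℝ L · B) ·ᵥ (D ·ᵥ x)) i ∎

    Dx≥0 : ∀ {x} → (∀ i → 0# ≤ x i) → ∀ i → 0# ≤ (D ·ᵥ x) i
    Dx≥0 {x} x≥0 i = ≤-respʳ-≈ (*-nonneg (inj₁ (D>0 i)) (x≥0 i)) (sym (diagonal-·ᵥ D-diag x i))

    D⁻¹ : ∀ i → ∃ λ d → D i i * d ≈ 1#
    D⁻¹ i = inverse (D i i) (λ Dᵢᵢ≈0 → <-irrefl (sym Dᵢᵢ≈0) (D>0 i))

    D⁻¹y : Vecℝ _ → Vecℝ _
    D⁻¹y y i = proj₁ (D⁻¹ i) * y i

    D⁻¹y≥0 : ∀ {y} → (∀ i → 0# ≤ y i) → ∀ i → 0# ≤ D⁻¹y y i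
    D⁻¹y≥0 y≥0 i = *-nonneg (inverse-nonneg (D>0 i) (proj₂ (D⁻¹ i))) (y≥0 i)

    D·D⁻¹y : ∀ y i → (D ·ᵥ D⁻¹y y) i ≈ y i
    D·D⁻¹y y i = begin
      (D ·ᵥ D⁻¹y y) i                  ≈⟨ diagonal-·ᵥ D-diag (D⁻¹y y) i ⟩
      D i i * (proj₁ (D⁻¹ i) * y i)    ≈⟨ *-assoc _ _ _ ⟨
      (D i i * proj₁ (D⁻¹ i)) * y i    ≈⟨ *-congʳ (proj₂ (D⁻¹ i)) ⟩
      1# * y i                         ≈⟨ *-identityˡ (y i) ⟩
      y i                              ∎

  positiveDiagonal : ∀ {n} {D M : Mat n} → NonnegDiagonal D → MMatrix (D · M) → PositiveDiagonal D
  positiveDiagonal {D = D} {M} (D-diag , D≥0) mDM = D-diag , D>0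
    where
    D>0 : ∀ i → 0# < D i i
    D>0 i with D≥0 i
    ... | inj₁ 0<Dᵢᵢ = 0<Dᵢᵢ
    ... | inj₂ 0≈Dᵢᵢ = ⊥-elim (<-irrefl refl (<-resp-≈ refl DMᵢᵢ≈0 (MMatrix.diagPos mDM i)))
      where
      DMᵢᵢ≈0 : (D · M) i i ≈ 0#
      DMᵢᵢ≈0 = trans (diagonal-·ᵥ D-diag (λ k → M k i) i) (trans (*-congʳ (sym 0≈Dᵢᵢ)) (zeroˡ _))

open Configurations using (superstable-⇔; critical-⇔; S⁺-invariant-under-diagonalRescaling; positiveDiagonal)
open MatrixAlgebra using (rightInverse≈leftInverse·factor)

mainTheorem7 : (R : RealField) → (n : ℕ) → let open Linear R in
    (L : ZMat n) → Invertible (toℝ L) →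
    (D M : Mat n) → NonnegDiagonal D →
    (mM : MMatrix M) → (mDM : MMatrix (D · M)) →
    (∀ f → Pairing.Superstable L mM f ⇔ Pairing.Superstable L mDM f) ×
    (∀ f → Pairing.Critical L mM f ⇔ Pairing.Critical L mDM f)
mainTheorem7 R n L _ D M D≥0 mM mDM =
  superstable-⇔ R L mM mDM sameS⁺ , critical-⇔ R L mM mDM sameS⁺
  where
  open Linear R using (MMatrix)
  sameS⁺ : Configurations.EqualS⁺ R L mM mDM
  sameS⁺ = S⁺-invariant-under-diagonalRescaling R L mM mDM (positiveDiagonal R D≥0 mDM)
             (rightInverse≈leftInverse·factor R (proj₂ (MMatrix.isInverse mDM)) (proj₁ (MMatrix.isInverse mM)))
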